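{- Let $\ell>0$ be an integer. Then $F(\ell-\log_2 B(\ell)-1)\ge \ell$. In addition, if $B(\ell)=B(\ell+1)$, then $F(\ell-\log_2 B(\ell)-1)=\ell$.
   Context: Cards of the EvenQuads-$2^n$ deck are the elements of $\mathbb{Z}_2^n$. A quad is a set of four distinct cards $\vec a,\vec b,\vec c,\vec d$ with $\vec a+\vec b+\vec c+\vec d=\vec 0$. A no-quads set is a set of cards containing no quad. $F(n)$ is the maximum number of cards in a no-quads subset of $\mathbb{Z}_2^n$. $B(\ell)$ is the largest possible number of codewords in a linear binary code of length $\ell$ (a linear subspace of $\mathbb{Z}_2^\ell$) with minimum Hamming distance at least 6, i.e. every nonzero codeword has at least 6 ones (so $B(\ell)$ is a power of 2). -}

module Defs where

open import Data.Bool using (Bool; true; false; _xor_)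
open import Data.Nat using (ℕ; zero; suc; _≤_)
open import Data.Vec using (Vec; zipWith; replicate; count)
open import Data.List using (List; length)
open import Data.List.Membership.Propositional using (_∈_)
open import Data.List.Relation.Unary.Unique.Propositional using (Unique)
open import Data.Product using (Σ; _×_)
open import Relation.Binary.PropositionalEquality using (_≡_; _≢_)
open import Relation.Nullary using (¬_)
open import Data.Bool.Properties using (T?)

-- A card of the EvenQuads-2^n deck: an element of Z_2^n (true = 1).
Card : ℕ → Set
Card n = Vec Bool n

_⊕_ : {n : ℕ} → Card n → Card n → Card n
_⊕_ = zipWith _xor_

infixl 6 _⊕_

𝟘 : (n : ℕ) → Card n
𝟘 n = replicate n false

IsQuad : {n : ℕ} → Card n → Card n → Card n → Card n → Set
IsQuad {n} a b c d =
  a ≢ b × a ≢ c × a ≢ d × b ≢ c × b ≢ d × c ≢ d × (a ⊕ b ⊕ c ⊕ d ≡ 𝟘 n)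

NoQuads : {n : ℕ} → List (Card n) → Set
NoQuads {n} S =
  Unique S ×
  ((a b c d : Card n) → a ∈ S → b ∈ S → c ∈ S → d ∈ S → ¬ IsQuad a b c d)

-- IsF n m : m = F(n), the maximum size of a no-quads subset of Z_2^n.
IsF : ℕ → ℕ → Set
IsF n m =
  Σ (List (Card n)) (λ S → NoQuads S × length S ≡ m) ×
  ((S : List (Card n)) → NoQuads S → length S ≤ m)

weight : {ℓ : ℕ} → Vec Bool ℓ → ℕ
weight = count (λ x → T? x)

-- A linear binary code of length ℓ (a subspace of Z_2^ℓ, given as a
-- duplicate-free list of its codewords) with minimum distance ≥ 6.
LinearCode6 : (ℓ : ℕ) → List (Vec Bool ℓ) → Set
LinearCode6 ℓ C =
  Unique C ×
  (𝟘 ℓ ∈ C) ×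
  ((x y : Vec Bool ℓ) → x ∈ C → y ∈ C → x ⊕ y ∈ C) ×
  ((x : Vec Bool ℓ) → x ∈ C → x ≢ 𝟘 ℓ → 6 ≤ weight x)

-- IsB ℓ b : b = B(ℓ), the largest number of codewords of such a code.
IsB : ℕ → ℕ → Set
IsB ℓ b =
  Σ (List (Vec Bool ℓ)) (λ C → LinearCode6 ℓ C × length C ≡ b) ×
  ((C : List (Vec Bool ℓ)) → LinearCode6 ℓ C → length C ≤ b)

-- Let m = ℓ - k - 1. Given a linear code C ⊆ Z₂^ℓ with 2ᵏ words and minimum distance 6,
-- adjoin a unit vector e: D = C ∪ (C + e) has 2ᵏ⁺¹ words, and its nonzero even words still
-- have weight ≥ 6. D is the kernel of a linear map H : Z₂^ℓ → Z₂ᵐ, and the ℓ columns of H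
-- form a no-quads set, since a repeated column or a quad would be an even word of D of
-- weight 2 or 4. Conversely, ℓ + 1 points s₁, …, s_{ℓ+1} of a no-quads set in Z₂ᵐ give
-- the code {x ∈ Z₂^(ℓ+1) ∣ x even, Σ xᵢ sᵢ = 0} of minimum distance 6 with at least
-- 2^(ℓ+1-(m+1)) = 2ᵏ⁺¹ > B(ℓ) words, impossible if B(ℓ + 1) = B(ℓ). All dimensions are
-- handled by counting points.

module Submission where

open import Defs
open import Algebra.Bundles using (CommutativeRing)
open import Data.Bool using (Bool; true; false; _xor_; not; _∧_; _∨_; if_then_else_)
open import Data.Bool.Properties
  using (xor-∧-commutativeRing; xor-assoc; xor-comm; xor-identityˡ; xor-identityʳ; xor-same; ⇔→≡; ∨-zeroʳ)
  renaming (_≟_ to _≟ᵇ_)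
open import Data.Empty using (⊥; ⊥-elim)
open import Data.Fin using (Fin; zero; suc; inject≤)
open import Data.Fin.Properties
  using (inject≤-injective) renaming (_≟_ to _≟ᶠ_; suc-injective to suc-injectiveᶠ)
open import Data.List using (List; []; _∷_; length; map; foldr; _++_; tabulate; lookup)
open import Data.List.Properties using (length-map; length-++; length-tabulate; map-∘)
import Data.List.Membership.DecPropositional as DecMembership
open import Data.List.Membership.Propositional using (_∈_)
open import Data.List.Membership.Propositional.Properties
  using (∈-++⁺ˡ; ∈-++⁺ʳ; ∈-++⁻; ∈-map⁺; ∈-map⁻; ∈-tabulate⁻; ∈-lookup)
open import Data.List.Membership.Propositional.Properties.WithK using (unique∧set⇒bag)
open import Data.List.Relation.Binary.BagAndSetEquality using (∼bag⇒↭)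
open import Data.List.Relation.Binary.Permutation.Propositional.Properties using (↭-length)
import Data.List.Relation.Unary.All as All
import Data.List.Relation.Unary.AllPairs as AllPairs
open import Data.List.Relation.Unary.Any using (here)
open import Data.List.Relation.Unary.Unique.Propositional using (Unique)
import Data.List.Relation.Unary.Unique.Propositional.Properties as Unique
open import Data.Nat using (ℕ; zero; suc; _<_; _≤_; _∸_; _^_; _+_; _*_; z≤n; s≤s)
open import Data.Nat.Properties
open import Data.Product using (Σ-syntax; ∃-syntax; _×_; _,_; proj₁; proj₂)
open import Data.Sum using (_⊎_; inj₁; inj₂)
open import Data.Vec using ([]; _∷_; head; tail) renaming (lookup to _!_)
open import Data.Vec.Properties
  using (≡-dec; ∷-injective; ∷-injectiveʳ; lookup-zipWith; lookup-replicate;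
         zipWith-assoc; zipWith-comm; zipWith-identityˡ; zipWith-identityʳ)
open import Function using (_∘_)
open import Function.Bundles using (_⇔_; mk⇔)
open import Relation.Binary.PropositionalEquality
open import Relation.Nullary using (¬_; Dec; yes; no; does)
open import Relation.Nullary.Decidable using (dec-true)

open import Algebra.Properties.CommutativeSemigroup +-commutativeSemigroup
  using () renaming (interchange to +-interchange)
open import Algebra.Properties.CommutativeSemigroup
  (CommutativeRing.+-commutativeSemigroup xor-∧-commutativeRing)
  using () renaming (interchange to xor-interchange)

-- The group Z₂ᵐ

⊕-assoc : ∀ {m} (x y z : Card m) → (x ⊕ y) ⊕ z ≡ x ⊕ (y ⊕ z)
⊕-assoc = zipWith-assoc xor-assoc

⊕-comm : ∀ {m} (x y : Card m) → x ⊕ y ≡ y ⊕ x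
⊕-comm = zipWith-comm xor-comm

⊕-identityˡ : ∀ {m} (x : Card m) → 𝟘 m ⊕ x ≡ x
⊕-identityˡ = zipWith-identityˡ xor-identityˡ

⊕-identityʳ : ∀ {m} (x : Card m) → x ⊕ 𝟘 m ≡ x
⊕-identityʳ = zipWith-identityʳ xor-identityʳ

⊕-self : ∀ {m} (x : Card m) → x ⊕ x ≡ 𝟘 m
⊕-self []      = refl
⊕-self (a ∷ x) = cong₂ _∷_ (xor-same a) (⊕-self x)

x⊕y⊕y≡x : ∀ {m} (x y : Card m) → x ⊕ y ⊕ y ≡ x
x⊕y⊕y≡x x y = begin
  x ⊕ y ⊕ y   ≡⟨ ⊕-assoc x y y ⟩
  x ⊕ (y ⊕ y) ≡⟨ cong (x ⊕_) (⊕-self y) ⟩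
  x ⊕ 𝟘 _     ≡⟨ ⊕-identityʳ x ⟩
  x           ∎
  where open ≡-Reasoning

x⊕[x⊕y]≡y : ∀ {m} (x y : Card m) → x ⊕ (x ⊕ y) ≡ y
x⊕[x⊕y]≡y x y = begin
  x ⊕ (x ⊕ y) ≡⟨ ⊕-assoc x x y ⟨
  x ⊕ x ⊕ y   ≡⟨ cong (_⊕ y) (⊕-self x) ⟩
  𝟘 _ ⊕ y     ≡⟨ ⊕-identityˡ y ⟩
  y           ∎
  where open ≡-Reasoning

x⊕y≡𝟘⇒x≡y : ∀ {m} {x y : Card m} → x ⊕ y ≡ 𝟘 m → x ≡ y
x⊕y≡𝟘⇒x≡y {x = x} {y} x⊕y≡𝟘 = begin
  x           ≡⟨ sym (x⊕y⊕y≡x x y) ⟩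
  x ⊕ y ⊕ y   ≡⟨ cong (_⊕ y) x⊕y≡𝟘 ⟩
  𝟘 _ ⊕ y     ≡⟨ ⊕-identityˡ y ⟩
  y           ∎
  where open ≡-Reasoning

⊕-interchange : ∀ {m} (x y z w : Card m) → (x ⊕ y) ⊕ (z ⊕ w) ≡ (x ⊕ z) ⊕ (y ⊕ w)
⊕-interchange []      []      []      []      = refl
⊕-interchange (a ∷ x) (b ∷ y) (c ∷ z) (d ∷ w) =
  cong₂ _∷_ (xor-interchange a b c d) (⊕-interchange x y z w)

-- Subsets of Z₂ᵐ, as Boolean predicates: counting and listing

card : (m : ℕ) → (Card m → Bool) → ℕ
card zero    P = if P [] then 1 else 0
card (suc m) P = card m (P ∘ (true ∷_)) + card m (P ∘ (false ∷_))

card-cong : ∀ {m} (P Q : Card m → Bool) → (∀ x → P x ≡ Q x) → card m P ≡ card m Q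
card-cong {zero}  P Q P≗Q rewrite P≗Q [] = refl
card-cong {suc m} P Q P≗Q =
  cong₂ _+_ (card-cong _ _ (P≗Q ∘ (true ∷_))) (card-cong _ _ (P≗Q ∘ (false ∷_)))

card-translate : ∀ {m} (P : Card m → Bool) (v : Card m) → card m (λ x → P (x ⊕ v)) ≡ card m P
card-translate {zero}  P []          = refl
card-translate {suc m} P (false ∷ v) =
  cong₂ _+_ (card-translate (P ∘ (true ∷_)) v) (card-translate (P ∘ (false ∷_)) v)
card-translate {suc m} P (true ∷ v)  = begin
  card m (λ x → P (false ∷ x ⊕ v)) + card m (λ x → P (true ∷ x ⊕ v))
    ≡⟨ cong₂ _+_ (card-translate (P ∘ (false ∷_)) v) (card-translate (P ∘ (true ∷_)) v) ⟩
  card m (P ∘ (false ∷_)) + card m (P ∘ (true ∷_))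
    ≡⟨ +-comm (card m (P ∘ (false ∷_))) _ ⟩
  card m (P ∘ (true ∷_)) + card m (P ∘ (false ∷_))
    ∎
  where open ≡-Reasoning

card-split : ∀ {m} (P Q : Card m → Bool) →
             card m P ≡ card m (λ x → Q x ∧ P x) + card m (λ x → not (Q x) ∧ P x)
card-split {zero} P Q with Q [] | P []
... | false | false = refl
... | false | true  = refl
... | true  | false = refl
... | true  | true  = refl
card-split {suc m} P Q = begin
  card m P₁ + card m P₀
    ≡⟨ cong₂ _+_ (card-split P₁ (Q ∘ (true ∷_))) (card-split P₀ (Q ∘ (false ∷_))) ⟩
  (a₁ + b₁) + (a₀ + b₀)
    ≡⟨ +-interchange a₁ b₁ a₀ b₀ ⟩
  (a₁ + a₀) + (b₁ + b₀)
    ∎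
  where
  open ≡-Reasoning
  P₁ = P ∘ (true ∷_)
  P₀ = P ∘ (false ∷_)
  a₁ = card m (λ x → Q (true ∷ x) ∧ P₁ x)
  b₁ = card m (λ x → not (Q (true ∷ x)) ∧ P₁ x)
  a₀ = card m (λ x → Q (false ∷ x) ∧ P₀ x)
  b₀ = card m (λ x → not (Q (false ∷ x)) ∧ P₀ x)

card≢0⇒nonempty : ∀ {m} (P : Card m → Bool) → card m P ≢ 0 → ∃[ x ] P x ≡ true
card≢0⇒nonempty {zero} P ≢0 with P [] in eq
... | true  = [] , eq
... | false = ⊥-elim (≢0 refl)
card≢0⇒nonempty {suc m} P ≢0 with card m (P ∘ (true ∷_)) ≟ 0
... | no ≢0₁ = let x , Px = card≢0⇒nonempty _ ≢0₁ in true ∷ x , Px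
... | yes ≡0₁ = let x , Px = card≢0⇒nonempty _ (λ ≡0₀ → ≢0 (cong₂ _+_ ≡0₁ ≡0₀)) in false ∷ x , Px

card-full : ∀ m → card m (λ _ → true) ≡ 2 ^ m
card-full zero    = refl
card-full (suc m) = cong₂ _+_ (card-full m) (trans (card-full m) (sym (+-identityʳ _)))

enumerate : (m : ℕ) → (Card m → Bool) → List (Card m)
enumerate zero    P = if P [] then [] ∷ [] else []
enumerate (suc m) P =
  map (true ∷_) (enumerate m (P ∘ (true ∷_))) ++ map (false ∷_) (enumerate m (P ∘ (false ∷_)))

length-enumerate : ∀ {m} (P : Card m → Bool) → length (enumerate m P) ≡ card m P
length-enumerate {zero} P with P []
... | true  = refl
... | false = refl
length-enumerate {suc m} P = begin
  length (map (true ∷_) L₁ ++ map (false ∷_) L₀)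
    ≡⟨ length-++ (map (true ∷_) L₁) ⟩
  length (map (true ∷_) L₁) + length (map (false ∷_) L₀)
    ≡⟨ cong₂ _+_ (length-map _ L₁) (length-map _ L₀) ⟩
  length L₁ + length L₀
    ≡⟨ cong₂ _+_ (length-enumerate (P ∘ (true ∷_))) (length-enumerate (P ∘ (false ∷_))) ⟩
  card m (P ∘ (true ∷_)) + card m (P ∘ (false ∷_))
    ∎
  where
  open ≡-Reasoning
  L₁ = enumerate m (P ∘ (true ∷_))
  L₀ = enumerate m (P ∘ (false ∷_))

∈-enumerate⁺ : ∀ {m} (P : Card m → Bool) {x} → P x ≡ true → x ∈ enumerate m P
∈-enumerate⁺ {zero}  P {[]}        Px rewrite Px = here refl
∈-enumerate⁺ {suc m} P {true ∷ x}  Px = ∈-++⁺ˡ (∈-map⁺ (true ∷_) (∈-enumerate⁺ _ Px))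
∈-enumerate⁺ {suc m} P {false ∷ x} Px =
  ∈-++⁺ʳ (map (true ∷_) (enumerate m (P ∘ (true ∷_)))) (∈-map⁺ (false ∷_) (∈-enumerate⁺ _ Px))

∈-enumerate⁻ : ∀ {m} (P : Card m → Bool) {x} → x ∈ enumerate m P → P x ≡ true
∈-enumerate⁻ {zero} P {[]} x∈ with P []
... | true = refl
∈-enumerate⁻ {suc m} P x∈ with ∈-++⁻ (map (true ∷_) (enumerate m (P ∘ (true ∷_)))) x∈
... | inj₁ x∈₁ with ∈-map⁻ (true ∷_) x∈₁
...   | _ , y∈ , refl = ∈-enumerate⁻ _ y∈
∈-enumerate⁻ {suc m} P x∈ | inj₂ x∈₀ with ∈-map⁻ (false ∷_) x∈₀
...   | _ , y∈ , refl = ∈-enumerate⁻ _ y∈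

enumerate-unique : ∀ {m} (P : Card m → Bool) → Unique (enumerate m P)
enumerate-unique {zero} P with P []
... | true  = All.[] AllPairs.∷ AllPairs.[]
... | false = AllPairs.[]
enumerate-unique {suc m} P =
  Unique.++⁺ (Unique.map⁺ ∷-injectiveʳ (enumerate-unique _))
             (Unique.map⁺ ∷-injectiveʳ (enumerate-unique _))
             disjoint
  where
  disjoint : ∀ {v} → v ∈ map (true ∷_) (enumerate m (P ∘ (true ∷_))) ×
                     v ∈ map (false ∷_) (enumerate m (P ∘ (false ∷_))) → ⊥
  disjoint (v∈₁ , v∈₀) with ∈-map⁻ (true ∷_) v∈₁ | ∈-map⁻ (false ∷_) v∈₀
  ... | _ , _ , refl | _ , _ , ()

does≡true⇒ : ∀ {A : Set} (a? : Dec A) → does a? ≡ true → A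
does≡true⇒ (yes a) _ = a

_∈?_ : ∀ {m} (x : Card m) (C : List (Card m)) → Dec (x ∈ C)
_∈?_ = DecMembership._∈?_ (≡-dec _≟ᵇ_)

_∈ᵇ_ : ∀ {m} → Card m → List (Card m) → Bool
x ∈ᵇ C = does (x ∈? C)

∈ᵇ⇒∈ : ∀ {m} {x : Card m} {C} → x ∈ᵇ C ≡ true → x ∈ C
∈ᵇ⇒∈ {x = x} {C} = does≡true⇒ (x ∈? C)

∈⇒∈ᵇ : ∀ {m} {x : Card m} {C} → x ∈ C → x ∈ᵇ C ≡ true
∈⇒∈ᵇ {x = x} {C} = dec-true (x ∈? C)

card-∈ᵇ : ∀ {m} (C : List (Card m)) → Unique C → card m (_∈ᵇ C) ≡ length C
card-∈ᵇ {m} C C-unique = begin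
  card m (_∈ᵇ C)               ≡⟨ length-enumerate (_∈ᵇ C) ⟨
  length (enumerate m (_∈ᵇ C))
    ≡⟨ ↭-length (∼bag⇒↭ (unique∧set⇒bag (enumerate-unique _) C-unique same-members)) ⟩
  length C                     ∎
  where
  open ≡-Reasoning
  same-members : ∀ {x} → x ∈ enumerate m (_∈ᵇ C) ⇔ x ∈ C
  same-members = mk⇔ (∈ᵇ⇒∈ ∘ ∈-enumerate⁻ (_∈ᵇ C)) (∈-enumerate⁺ (_∈ᵇ C) ∘ ∈⇒∈ᵇ)

-- Subspaces, linear maps and parity-check maps

record IsSubspace {m} (P : Card m → Bool) : Set where
  field
    𝟘∈       : P (𝟘 m) ≡ true
    ⊕-closed : ∀ x y → P x ≡ true → P y ≡ true → P (x ⊕ y) ≡ true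

open IsSubspace

subspace-false∷ : ∀ {m} {P : Card (suc m) → Bool} → IsSubspace P → IsSubspace (P ∘ (false ∷_))
subspace-false∷ S = record { 𝟘∈ = 𝟘∈ S ; ⊕-closed = λ x y → ⊕-closed S (false ∷ x) (false ∷ y) }

translate-invariant : ∀ {m} {P : Card m → Bool} → IsSubspace P →
                      ∀ {v} → P v ≡ true → ∀ x → P (x ⊕ v) ≡ P x
translate-invariant {P = P} S {v} Pv x = ⇔→≡ (mk⇔
  (λ Px⊕v → subst (λ y → P y ≡ true) (x⊕y⊕y≡x x v) (⊕-closed S _ _ Px⊕v Pv))
  (λ Px → ⊕-closed S _ _ Px Pv))

Linear : ∀ {m r} → (Card m → Card r) → Set
Linear ψ = ∀ x y → ψ (x ⊕ y) ≡ ψ x ⊕ ψ y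

LinearForm : ∀ {m} → (Card m → Bool) → Set
LinearForm g = ∀ x y → g (x ⊕ y) ≡ g x xor g y

linear-𝟘 : ∀ {m r} (ψ : Card m → Card r) → Linear ψ → ψ (𝟘 m) ≡ 𝟘 r
linear-𝟘 {m} ψ ψ-linear = begin
  ψ (𝟘 m)           ≡⟨ cong ψ (sym (⊕-self (𝟘 m))) ⟩
  ψ (𝟘 m ⊕ 𝟘 m)     ≡⟨ ψ-linear _ _ ⟩
  ψ (𝟘 m) ⊕ ψ (𝟘 m) ≡⟨ ⊕-self _ ⟩
  𝟘 _               ∎
  where open ≡-Reasoning

scale : ∀ {m} → Bool → Card m → Card m
scale true  v = v
scale false v = 𝟘 _

scale-xor : ∀ {m} a b (v : Card m) → scale (a xor b) v ≡ scale a v ⊕ scale b v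
scale-xor false false v = sym (⊕-self (𝟘 _))
scale-xor false true  v = sym (⊕-identityˡ v)
scale-xor true  false v = sym (⊕-identityʳ v)
scale-xor true  true  v = sym (⊕-self v)

half-of-power : ∀ {k} c → c + c ≡ 2 ^ k → ∃[ j ] k ≡ suc j × c ≡ 2 ^ j
half-of-power {zero} zero    ()
half-of-power {zero} (suc c) c+c≡1 = ⊥-elim (1+n≢0 (trans (sym (+-suc c c)) (suc-injective c+c≡1)))
half-of-power {suc j} c c+c≡2^1+j =
  j , refl , *-cancelˡ-≡ c (2 ^ j) 2 (trans (cong (c +_) (+-identityʳ c)) c+c≡2^1+j)

-- Only ker H ⊆ P is recorded; equality would follow by counting.
record ParityCheck {m} (k : ℕ) (P : Card m → Bool) : Set where
  field
    r       : ℕ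
    r+k≡m   : r + k ≡ m
    H       : Card m → Card r
    linear  : Linear H
    ker⊆    : ∀ x → H x ≡ 𝟘 r → P x ≡ true

parityCheck-addRow : ∀ {m k} {P : Card (suc m) → Bool} →
                     ParityCheck k (P ∘ (false ∷_)) → ParityCheck k P
parityCheck-addRow {P = P} C = record
  { r = suc r ; r+k≡m = cong suc r+k≡m ; H = H′ ; linear = H′-linear ; ker⊆ = H′-ker⊆ }
  where
  open ParityCheck C
  H′ : Card _ → Card (suc r)
  H′ (b ∷ x) = b ∷ H x
  H′-linear : Linear H′
  H′-linear (a ∷ x) (b ∷ y) = cong ((a xor b) ∷_) (linear x y)
  H′-ker⊆ : ∀ x → H′ x ≡ 𝟘 (suc r) → P x ≡ true
  H′-ker⊆ (b ∷ x) H′x≡𝟘 with ∷-injective H′x≡𝟘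
  ... | refl , Hx≡𝟘 = ker⊆ x Hx≡𝟘

-- H′ first projects Z₂^(1+m) onto Z₂ᵐ along (1 ∷ v).
parityCheck-project : ∀ {m k} {P : Card (suc m) → Bool} →
                      IsSubspace P → ∀ {v} → P (true ∷ v) ≡ true →
                      ParityCheck k (P ∘ (false ∷_)) → ParityCheck (suc k) P
parityCheck-project {m} {k} {P} S {v} P[1∷v] C = record
  { r = r ; r+k≡m = trans (+-suc r k) (cong suc r+k≡m)
  ; H = H′ ; linear = H′-linear ; ker⊆ = H′-ker⊆ }
  where
  open ParityCheck C
  H′ : Card (suc m) → Card r
  H′ (b ∷ x) = H (x ⊕ scale b v)
  H′-linear : Linear H′
  H′-linear (a ∷ x) (b ∷ y) = begin
    H ((x ⊕ y) ⊕ scale (a xor b) v)          ≡⟨ cong (λ s → H ((x ⊕ y) ⊕ s)) (scale-xor a b v) ⟩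
    H ((x ⊕ y) ⊕ (scale a v ⊕ scale b v))    ≡⟨ cong H (⊕-interchange x y _ _) ⟩
    H ((x ⊕ scale a v) ⊕ (y ⊕ scale b v))    ≡⟨ linear _ _ ⟩
    H (x ⊕ scale a v) ⊕ H (y ⊕ scale b v)    ∎
    where open ≡-Reasoning
  H′-ker⊆ : ∀ x → H′ x ≡ 𝟘 r → P x ≡ true
  H′-ker⊆ (false ∷ x) H′x≡𝟘 = subst (λ y → P (false ∷ y) ≡ true) (⊕-identityʳ x) (ker⊆ _ H′x≡𝟘)
  H′-ker⊆ (true ∷ x)  H′x≡𝟘 = subst (λ y → P (true ∷ y) ≡ true) (x⊕y⊕y≡x x v)
    (⊕-closed S (false ∷ (x ⊕ v)) (true ∷ v) (ker⊆ _ H′x≡𝟘) P[1∷v])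

card-halves : ∀ {m} {P : Card (suc m) → Bool} → IsSubspace P → ∀ {v} → P (true ∷ v) ≡ true →
              card m (P ∘ (true ∷_)) ≡ card m (P ∘ (false ∷_))
card-halves {m} {P} S {v} P[1∷v] = begin
  card m (P ∘ (true ∷_))               ≡⟨ card-translate (P ∘ (true ∷_)) v ⟨
  card m (λ x → P (true ∷ (x ⊕ v)))    ≡⟨ card-cong _ _ (translate-invariant S P[1∷v] ∘ (false ∷_)) ⟩
  card m (P ∘ (false ∷_))              ∎
  where open ≡-Reasoning

subspace-parityCheck : ∀ {m} k (P : Card m → Bool) → IsSubspace P → card m P ≡ 2 ^ k →
                       ParityCheck k P
subspace-parityCheck {zero} zero P S _ = record
  { r = 0 ; r+k≡m = refl ; H = λ _ → [] ; linear = λ _ _ → refl ; ker⊆ = λ { [] _ → 𝟘∈ S } }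
subspace-parityCheck {zero} (suc k) P S ∣P∣≡2^k rewrite 𝟘∈ S =
  ⊥-elim (<⇒≢ (^-monoʳ-< 2 (s≤s (s≤s z≤n)) (s≤s (z≤n {k}))) ∣P∣≡2^k)
subspace-parityCheck {suc m} k P S ∣P∣≡2^k with card m (P ∘ (true ∷_)) ≟ 0
... | yes ∣P₁∣≡0 = parityCheck-addRow (subspace-parityCheck k _ (subspace-false∷ S)
      (trans (cong (_+ card m (P ∘ (false ∷_))) (sym ∣P₁∣≡0)) ∣P∣≡2^k))
... | no ∣P₁∣≢0 with card≢0⇒nonempty (P ∘ (true ∷_)) ∣P₁∣≢0
...   | v , P[1∷v] with half-of-power {k} (card m (P ∘ (false ∷_)))
  (trans (cong (_+ card m (P ∘ (false ∷_))) (sym (card-halves S P[1∷v]))) ∣P∣≡2^k)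
...     | j , refl , ∣P₀∣≡2^j =
  parityCheck-project S P[1∷v] (subspace-parityCheck j _ (subspace-false∷ S) ∣P₀∣≡2^j)

isZero : ∀ {r} → Card r → Bool
isZero []      = true
isZero (b ∷ v) = not b ∧ isZero v

isZero-𝟘 : ∀ r → isZero (𝟘 r) ≡ true
isZero-𝟘 zero    = refl
isZero-𝟘 (suc r) = isZero-𝟘 r

isZero⇒≡𝟘 : ∀ {r} (v : Card r) → isZero v ≡ true → v ≡ 𝟘 r
isZero⇒≡𝟘 []          _      = refl
isZero⇒≡𝟘 (false ∷ v) isZero = cong (false ∷_) (isZero⇒≡𝟘 v isZero)

kernel : ∀ {m r} → (Card m → Card r) → Card m → Bool
kernel ψ x = isZero (ψ x)

kernel-subspace : ∀ {m r} (ψ : Card m → Card r) → Linear ψ → IsSubspace (kernel ψ)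
kernel-subspace {m} {r} ψ ψ-linear = record
  { 𝟘∈      = subst (λ v → isZero v ≡ true) (sym (linear-𝟘 ψ ψ-linear)) (isZero-𝟘 r)
  ; ⊕-closed = λ x y ψx≡𝟘 ψy≡𝟘 → subst (λ v → isZero v ≡ true)
      (sym (begin
        ψ (x ⊕ y)   ≡⟨ ψ-linear x y ⟩
        ψ x ⊕ ψ y   ≡⟨ cong₂ _⊕_ (isZero⇒≡𝟘 _ ψx≡𝟘) (isZero⇒≡𝟘 _ ψy≡𝟘) ⟩
        𝟘 r ⊕ 𝟘 r   ≡⟨ ⊕-self (𝟘 r) ⟩
        𝟘 r         ∎))
      (isZero-𝟘 r)
  }
  where open ≡-Reasoning

∧≡true : ∀ {a b} → a ∧ b ≡ true → a ≡ true × b ≡ true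
∧≡true {true} {true} _ = refl , refl

-- A linear functional g either vanishes on P or splits it into two translates.
card-coset≤card-hyperplane : ∀ {m} (P g : Card m → Bool) → IsSubspace P →
                   LinearForm g → card m (λ x → g x ∧ P x) ≤ card m (λ x → not (g x) ∧ P x)
card-coset≤card-hyperplane {m} P g S g-linear with card m (λ x → g x ∧ P x) ≟ 0
... | yes ≡0 = ≤-trans (≤-reflexive ≡0) z≤n
... | no ≢0 = ≤-reflexive (begin
  card m (λ x → g x ∧ P x)                     ≡⟨ card-cong _ _ shift ⟨
  card m (λ x → not (g (x ⊕ v)) ∧ P (x ⊕ v))   ≡⟨ card-translate (λ x → not (g x) ∧ P x) v ⟩
  card m (λ x → not (g x) ∧ P x)               ∎)
  where
  open ≡-Reasoning
  witness = card≢0⇒nonempty (λ x → g x ∧ P x) ≢0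
  v = proj₁ witness
  gv = proj₁ (∧≡true (proj₂ witness))
  Pv = proj₂ (∧≡true (proj₂ witness))
  not-xor-true : ∀ a → not (a xor true) ≡ a
  not-xor-true false = refl
  not-xor-true true  = refl
  shift : ∀ x → not (g (x ⊕ v)) ∧ P (x ⊕ v) ≡ g x ∧ P x
  shift x = cong₂ _∧_
    (trans (cong not (trans (g-linear x v) (cong (g x xor_) gv))) (not-xor-true (g x)))
    (translate-invariant S Pv x)

card≤2*card-hyperplane : ∀ {m} (P g : Card m → Bool) → IsSubspace P →
                                  LinearForm g → card m P ≤ 2 * card m (λ x → not (g x) ∧ P x)
card≤2*card-hyperplane {m} P g S g-linear = begin
  card m P                       ≡⟨ card-split P g ⟩
  card m (λ x → g x ∧ P x) + c   ≤⟨ +-monoˡ-≤ c (card-coset≤card-hyperplane P g S g-linear) ⟩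
  c + c                          ≡⟨ cong (c +_) (+-identityʳ c) ⟨
  2 * c                          ∎
  where
  open ≤-Reasoning
  c = card m (λ x → not (g x) ∧ P x)

isZero-head-tail : ∀ {r} (v : Card (suc r)) → isZero v ≡ not (head v) ∧ isZero (tail v)
isZero-head-tail (b ∷ v) = refl

2^m≤2^r*card-kernel : ∀ {m} r (ψ : Card m → Card r) → Linear ψ → 2 ^ m ≤ 2 ^ r * card m (kernel ψ)
2^m≤2^r*card-kernel {m} zero ψ _ = ≤-reflexive (begin-equality
  2 ^ m                          ≡⟨ card-full m ⟨
  card m (λ _ → true)            ≡⟨ card-cong _ _ (λ x → isZero-[] (ψ x)) ⟩
  card m (kernel ψ)              ≡⟨ +-identityʳ _ ⟨
  1 * card m (kernel ψ)          ∎)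
  where
  open ≤-Reasoning
  isZero-[] : (v : Card 0) → true ≡ isZero v
  isZero-[] [] = refl
2^m≤2^r*card-kernel {m} (suc r) ψ ψ-linear = begin
  2 ^ m                                               ≤⟨ 2^m≤2^r*card-kernel r t t-linear ⟩
  2 ^ r * card m (kernel t)                           ≤⟨ *-monoʳ-≤ (2 ^ r) halving ⟩
  2 ^ r * (2 * card m (λ x → not (h x) ∧ kernel t x)) ≡⟨ cong (λ c → 2 ^ r * (2 * c)) ker-ψ ⟩
  2 ^ r * (2 * card m (kernel ψ))                     ≡⟨ *-assoc (2 ^ r) 2 _ ⟨
  2 ^ r * 2 * card m (kernel ψ)                       ≡⟨ cong (_* card m (kernel ψ)) (*-comm (2 ^ r) 2) ⟩
  2 ^ suc r * card m (kernel ψ)                       ∎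
  where
  open ≤-Reasoning
  h = head ∘ ψ
  t = tail ∘ ψ
  t-linear : Linear t
  t-linear x y = trans (cong tail (ψ-linear x y)) (tail-⊕ (ψ x) (ψ y))
    where tail-⊕ : (u w : Card (suc r)) → tail (u ⊕ w) ≡ tail u ⊕ tail w
          tail-⊕ (_ ∷ _) (_ ∷ _) = refl
  h-linear : LinearForm h
  h-linear x y = trans (cong head (ψ-linear x y)) (head-⊕ (ψ x) (ψ y))
    where head-⊕ : (u w : Card (suc r)) → head (u ⊕ w) ≡ head u xor head w
          head-⊕ (_ ∷ _) (_ ∷ _) = refl
  halving = card≤2*card-hyperplane (kernel t) h (kernel-subspace t t-linear) h-linear
  ker-ψ : card m (λ x → not (h x) ∧ kernel t x) ≡ card m (kernel ψ)
  ker-ψ = card-cong _ _ (λ x → sym (isZero-head-tail (ψ x)))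

-- Parity and weight

parity : ∀ {m} → Card m → Bool
parity []      = false
parity (b ∷ x) = b xor parity x

isOdd : ℕ → Bool
isOdd zero    = false
isOdd (suc n) = not (isOdd n)

parity≡isOdd-weight : ∀ {m} (x : Card m) → parity x ≡ isOdd (weight x)
parity≡isOdd-weight []          = refl
parity≡isOdd-weight (true ∷ x)  = cong not (parity≡isOdd-weight x)
parity≡isOdd-weight (false ∷ x) = parity≡isOdd-weight x

parity-⊕ : ∀ {m} (x y : Card m) → parity (x ⊕ y) ≡ parity x xor parity y
parity-⊕ []      []      = refl
parity-⊕ (a ∷ x) (b ∷ y) = begin
  (a xor b) xor parity (x ⊕ y)          ≡⟨ cong ((a xor b) xor_) (parity-⊕ x y) ⟩
  (a xor b) xor (parity x xor parity y) ≡⟨ xor-interchange a b (parity x) (parity y) ⟩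
  (a xor parity x) xor (b xor parity y) ∎
  where open ≡-Reasoning

parity-𝟘 : ∀ m → parity (𝟘 m) ≡ false
parity-𝟘 zero    = refl
parity-𝟘 (suc m) = parity-𝟘 m

parity≡true⇒≢𝟘 : ∀ {m} {x : Card m} → parity x ≡ true → x ≢ 𝟘 m
parity≡true⇒≢𝟘 {m} odd refl with trans (sym odd) (parity-𝟘 m)
... | ()

!≡true⇒≢𝟘 : ∀ {m} {x : Card m} i → x ! i ≡ true → x ≢ 𝟘 m
!≡true⇒≢𝟘 i xᵢ≡true refl with trans (sym xᵢ≡true) (lookup-replicate i false)
... | ()

weight-𝟘 : ∀ m → weight (𝟘 m) ≡ 0
weight-𝟘 zero    = refl
weight-𝟘 (suc m) = weight-𝟘 m

weight-⊕ : ∀ {m} (x y : Card m) → weight (x ⊕ y) ≤ weight x + weight y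
weight-⊕ []          []          = z≤n
weight-⊕ (false ∷ x) (false ∷ y) = weight-⊕ x y
weight-⊕ (false ∷ x) (true ∷ y)  = ≤-trans (s≤s (weight-⊕ x y)) (≤-reflexive (sym (+-suc _ _)))
weight-⊕ (true ∷ x)  (false ∷ y) = s≤s (weight-⊕ x y)
weight-⊕ (true ∷ x)  (true ∷ y)  = ≤-trans (weight-⊕ x y) (+-mono-≤ (n≤1+n _) (n≤1+n _))

unit : ∀ {m} → Fin m → Card m
unit {suc m} zero    = true ∷ 𝟘 m
unit {suc m} (suc i) = false ∷ unit i

parity-unit : ∀ {m} (i : Fin m) → parity (unit i) ≡ true
parity-unit {suc m} zero    = cong not (parity-𝟘 m)
parity-unit {suc m} (suc i) = parity-unit i

weight-unit : ∀ {m} (i : Fin m) → weight (unit i) ≡ 1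
weight-unit {suc m} zero    = cong suc (weight-𝟘 m)
weight-unit {suc m} (suc i) = weight-unit i

unit-!-≡ : ∀ {m} (i : Fin m) → unit i ! i ≡ true
unit-!-≡ zero    = refl
unit-!-≡ (suc i) = unit-!-≡ i

unit-!-≢ : ∀ {m} {i j : Fin m} → j ≢ i → unit j ! i ≡ false
unit-!-≢ {i = zero}  {zero}  j≢i = ⊥-elim (j≢i refl)
unit-!-≢ {i = zero}  {suc j} j≢i = refl
unit-!-≢ {i = suc i} {zero}  j≢i = lookup-replicate i false
unit-!-≢ {i = suc i} {suc j} j≢i = unit-!-≢ (j≢i ∘ cong suc)

-- From a code to a no-quads set

∨≡true : ∀ {a b} → a ∨ b ≡ true → a ≡ true ⊎ b ≡ true
∨≡true {true}  _  = inj₁ refl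
∨≡true {false} Pb = inj₂ Pb

adjoin : ∀ {m} → (Card m → Bool) → Card m → Card m → Bool
adjoin P v x = P x ∨ P (x ⊕ v)

adjoin-subspace : ∀ {m} {P : Card m → Bool} → IsSubspace P → ∀ v → IsSubspace (adjoin P v)
adjoin-subspace {m} {P} S v = record
  { 𝟘∈      = cong (_∨ P (𝟘 m ⊕ v)) (𝟘∈ S)
  ; ⊕-closed = λ x y Ax Ay → closed x y (∨≡true Ax) (∨≡true Ay)
  }
  where
  inˡ : ∀ {x} → P x ≡ true → adjoin P v x ≡ true
  inˡ {x} Px = cong (_∨ P (x ⊕ v)) Px
  inʳ : ∀ {x} → P (x ⊕ v) ≡ true → adjoin P v x ≡ true
  inʳ {x} Px⊕v = trans (cong (P x ∨_) Px⊕v) (∨-zeroʳ (P x))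
  P-resp : ∀ {x y} → x ≡ y → P x ≡ true → P y ≡ true
  P-resp x≡y = subst (λ z → P z ≡ true) x≡y
  closed : ∀ x y → P x ≡ true ⊎ P (x ⊕ v) ≡ true → P y ≡ true ⊎ P (y ⊕ v) ≡ true →
           adjoin P v (x ⊕ y) ≡ true
  closed x y (inj₁ Px) (inj₁ Py) = inˡ (⊕-closed S x y Px Py)
  closed x y (inj₁ Px) (inj₂ Py⊕v) =
    inʳ (P-resp (sym (⊕-assoc x y v)) (⊕-closed S x (y ⊕ v) Px Py⊕v))
  closed x y (inj₂ Px⊕v) (inj₁ Py) =
    inʳ (P-resp (trans (⊕-assoc x v y) (trans (cong (x ⊕_) (⊕-comm v y)) (sym (⊕-assoc x y v))))
                (⊕-closed S (x ⊕ v) y Px⊕v Py))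
  closed x y (inj₂ Px⊕v) (inj₂ Py⊕v) =
    inˡ (P-resp (trans (⊕-interchange x v y v) (trans (cong (x ⊕ y ⊕_) (⊕-self v)) (⊕-identityʳ _)))
                (⊕-closed S (x ⊕ v) (y ⊕ v) Px⊕v Py⊕v))

card-adjoin : ∀ {m} {P : Card m → Bool} → IsSubspace P → ∀ {v} → P v ≡ false →
              card m (adjoin P v) ≡ card m P + card m P
card-adjoin {m} {P} S {v} Pv≡false = begin
  card m (adjoin P v)                                      ≡⟨ card-split (adjoin P v) P ⟩
  card m (λ x → P x ∧ adjoin P v x) + card m (λ x → not (P x) ∧ adjoin P v x)
    ≡⟨ cong₂ _+_ (card-cong _ _ inP) (trans (card-cong _ _ outP) (card-translate P v)) ⟩
  card m P + card m P                                      ∎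
  where
  open ≡-Reasoning
  inP : ∀ x → P x ∧ adjoin P v x ≡ P x
  inP x with P x
  ... | true  = refl
  ... | false = refl
  -- x and x ⊕ v cannot both lie in P, since their sum v does not
  outP : ∀ x → not (P x) ∧ adjoin P v x ≡ P (x ⊕ v)
  outP x with P x in Px | P (x ⊕ v) in Px⊕v
  ... | false | _     = refl
  ... | true  | false = refl
  ... | true  | true  = ⊥-elim (true≢false (begin
    true              ≡⟨ ⊕-closed S _ _ Px Px⊕v ⟨
    P (x ⊕ (x ⊕ v))   ≡⟨ cong P (x⊕[x⊕y]≡y x v) ⟩
    P v               ≡⟨ Pv≡false ⟩
    false             ∎))
    where true≢false : true ≢ false
          true≢false ()

parity-unit⊕unit : ∀ {m} (i j : Fin m) → parity (unit i ⊕ unit j) ≡ false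
parity-unit⊕unit i j =
  trans (parity-⊕ (unit i) (unit j)) (cong₂ _xor_ (parity-unit i) (parity-unit j))

weight-unit⊕unit : ∀ {m} (i j : Fin m) → weight (unit i ⊕ unit j) ≤ 2
weight-unit⊕unit i j =
  ≤-trans (weight-⊕ (unit i) (unit j)) (≤-reflexive (cong₂ _+_ (weight-unit i) (weight-unit j)))

unit⊕unit-!-≡ : ∀ {m} {i j : Fin m} → j ≢ i → (unit i ⊕ unit j) ! i ≡ true
unit⊕unit-!-≡ {i = i} {j} j≢i =
  trans (lookup-zipWith _xor_ i (unit i) (unit j)) (cong₂ _xor_ (unit-!-≡ i) (unit-!-≢ j≢i))

unit⊕unit-!-≢ : ∀ {m} {i j k : Fin m} → j ≢ i → k ≢ i → (unit j ⊕ unit k) ! i ≡ false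
unit⊕unit-!-≢ {i = i} {j} {k} j≢i k≢i =
  trans (lookup-zipWith _xor_ i (unit j) (unit k)) (cong₂ _xor_ (unit-!-≢ j≢i) (unit-!-≢ k≢i))

NoShortEvenWords : ∀ {m} → (Card m → Bool) → Set
NoShortEvenWords {m} P = ∀ w → P w ≡ true → w ≢ 𝟘 m → parity w ≡ false → 4 < weight w

-- A repeated column of H, or a quad of columns, is the image of a kernel word of weight 2 or 4.
columns-noQuads : ∀ {m k} {P : Card m → Bool} (C : ParityCheck k P) → NoShortEvenWords P →
                  NoQuads (tabulate (ParityCheck.H C ∘ unit))
columns-noQuads {m} C noShort = Unique.tabulate⁺ column-injective , no-quad
  where
  open ParityCheck C
  column = H ∘ unit
  long-even-words : ∀ w → H w ≡ 𝟘 r → w ≢ 𝟘 m → parity w ≡ false → 4 < weight w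
  long-even-words w = noShort w ∘ ker⊆ w
  H-pair : ∀ i j → H (unit i ⊕ unit j) ≡ column i ⊕ column j
  H-pair i j = linear (unit i) (unit j)
  column-injective : ∀ {i j} → column i ≡ column j → i ≡ j
  column-injective {i} {j} cᵢ≡cⱼ with i ≟ᶠ j
  ... | yes i≡j = i≡j
  ... | no  i≢j = ⊥-elim (<⇒≱ (long-even-words _ Hw≡𝟘 w≢𝟘 (parity-unit⊕unit i j))
                              (≤-trans (weight-unit⊕unit i j) (s≤s (s≤s z≤n))))
    where
    Hw≡𝟘 = trans (H-pair i j) (trans (cong (_⊕ column j) cᵢ≡cⱼ) (⊕-self (column j)))
    w≢𝟘 = !≡true⇒≢𝟘 i (unit⊕unit-!-≡ (i≢j ∘ sym))
  no-quad : ∀ a b c d → a ∈ tabulate column → b ∈ tabulate column → c ∈ tabulate column →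
            d ∈ tabulate column → ¬ IsQuad a b c d
  no-quad a b c d a∈ b∈ c∈ d∈ (a≢b , a≢c , a≢d , _ , _ , _ , a⊕b⊕c⊕d≡𝟘)
    with ∈-tabulate⁻ a∈ | ∈-tabulate⁻ b∈ | ∈-tabulate⁻ c∈ | ∈-tabulate⁻ d∈
  ... | i , refl | j , refl | k , refl | l , refl =
    <⇒≱ (long-even-words w Hw≡𝟘 w≢𝟘 even)
        (≤-trans (weight-⊕ (unit i ⊕ unit j) _)
                 (+-mono-≤ (weight-unit⊕unit i j) (weight-unit⊕unit k l)))
    where
    w = (unit i ⊕ unit j) ⊕ (unit k ⊕ unit l)
    Hw≡𝟘 : H w ≡ 𝟘 r
    Hw≡𝟘 = begin
      H w                                            ≡⟨ linear _ _ ⟩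
      H (unit i ⊕ unit j) ⊕ H (unit k ⊕ unit l)      ≡⟨ cong₂ _⊕_ (H-pair i j) (H-pair k l) ⟩
      (column i ⊕ column j) ⊕ (column k ⊕ column l)  ≡⟨ ⊕-assoc (column i ⊕ column j) _ _ ⟨
      column i ⊕ column j ⊕ column k ⊕ column l      ≡⟨ a⊕b⊕c⊕d≡𝟘 ⟩
      𝟘 r                                            ∎
      where open ≡-Reasoning
    even : parity w ≡ false
    even = trans (parity-⊕ (unit i ⊕ unit j) _)
                 (cong₂ _xor_ (parity-unit⊕unit i j) (parity-unit⊕unit k l))
    w≢𝟘 : w ≢ 𝟘 m
    w≢𝟘 = !≡true⇒≢𝟘 i (trans (lookup-zipWith _xor_ i (unit i ⊕ unit j) _)
            (cong₂ _xor_ (unit⊕unit-!-≡ (a≢b ∘ cong column ∘ sym))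
                         (unit⊕unit-!-≢ (a≢c ∘ cong column ∘ sym) (a≢d ∘ cong column ∘ sym))))

adjoin-unit-noShortEvenWords : ∀ {m} (P : Card m → Bool) (i : Fin m) →
                               (∀ x → P x ≡ true → x ≢ 𝟘 m → 6 ≤ weight x) →
                               NoShortEvenWords (adjoin P (unit i))
adjoin-unit-noShortEvenWords P i P-weight w w∈ w≢𝟘 even with ∨≡true w∈
... | inj₁ Pw = ≤-trans (n≤1+n 5) (P-weight w Pw w≢𝟘)
... | inj₂ Pw⊕e = +-cancelʳ-≤ 1 5 (weight w) (begin
  6                            ≤⟨ P-weight _ Pw⊕e (parity≡true⇒≢𝟘 odd) ⟩
  weight (w ⊕ unit i)          ≤⟨ weight-⊕ w (unit i) ⟩
  weight w + weight (unit i)   ≡⟨ cong (weight w +_) (weight-unit i) ⟩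
  weight w + 1                 ∎)
  where
  open ≤-Reasoning
  odd : parity (w ⊕ unit i) ≡ true
  odd = trans (parity-⊕ w (unit i)) (cong₂ _xor_ even (parity-unit i))

linearCode6⇒noQuads : ∀ {ℓ k} (C : List (Card (suc ℓ))) → LinearCode6 (suc ℓ) C → length C ≡ 2 ^ k →
                      ∃[ r ] r + suc k ≡ suc ℓ × Σ[ S ∈ List (Card r) ] NoQuads S × length S ≡ suc ℓ
linearCode6⇒noQuads {ℓ} {k} C (C-unique , 𝟘∈C , C-closed , C-weight) ∣C∣≡2^k =
  r , r+k≡m , tabulate (H ∘ unit) ,
  columns-noQuads D-check (adjoin-unit-noShortEvenWords P zero P-weight) , length-tabulate (H ∘ unit)
  where
  P = _∈ᵇ C
  P-subspace : IsSubspace P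
  P-subspace = record
    { 𝟘∈ = ∈⇒∈ᵇ 𝟘∈C ; ⊕-closed = λ x y Px Py → ∈⇒∈ᵇ (C-closed x y (∈ᵇ⇒∈ Px) (∈ᵇ⇒∈ Py)) }
  P-weight : ∀ x → P x ≡ true → x ≢ 𝟘 (suc ℓ) → 6 ≤ weight x
  P-weight x = C-weight x ∘ ∈ᵇ⇒∈
  e₀∉P : P (unit zero) ≡ false
  e₀∉P with P (unit zero) in e₀∈P
  ... | false = refl
  ... | true  = ⊥-elim (<⇒≱ (s≤s (s≤s z≤n)) (subst (6 ≤_) (weight-unit {suc ℓ} zero)
                  (P-weight (unit zero) e₀∈P (parity≡true⇒≢𝟘 (parity-unit {suc ℓ} zero)))))
  D = adjoin P (unit zero)
  ∣D∣≡2^1+k : card (suc ℓ) D ≡ 2 ^ suc k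
  ∣D∣≡2^1+k = begin
    card (suc ℓ) D                    ≡⟨ card-adjoin P-subspace e₀∉P ⟩
    card (suc ℓ) P + card (suc ℓ) P   ≡⟨ cong₂ _+_ ∣P∣≡2^k ∣P∣≡2^k ⟩
    2 ^ k + 2 ^ k                     ≡⟨ cong (2 ^ k +_) (+-identityʳ (2 ^ k)) ⟨
    2 ^ suc k                         ∎
    where
    open ≡-Reasoning
    ∣P∣≡2^k = trans (card-∈ᵇ C C-unique) ∣C∣≡2^k
  D-check = subspace-parityCheck (suc k) D (adjoin-subspace P-subspace (unit zero)) ∣D∣≡2^1+k
  open ParityCheck D-check

-- From a no-quads set to a code

support : ∀ {m} → Card m → List (Fin m)
support []          = []
support (true ∷ x)  = zero ∷ map suc (support x)
support (false ∷ x) = map suc (support x)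

length-support : ∀ {m} (x : Card m) → length (support x) ≡ weight x
length-support []          = refl
length-support (true ∷ x)  = cong suc (trans (length-map suc (support x)) (length-support x))
length-support (false ∷ x) = trans (length-map suc (support x)) (length-support x)

support-unique : ∀ {m} (x : Card m) → Unique (support x)
support-unique []          = AllPairs.[]
support-unique (true ∷ x)  =
  All.tabulate zero∉ AllPairs.∷ Unique.map⁺ suc-injectiveᶠ (support-unique x)
  where
  zero∉ : ∀ {i} → i ∈ map suc (support x) → zero ≢ i
  zero∉ i∈ with ∈-map⁻ suc i∈
  ... | _ , _ , refl = λ ()
support-unique (false ∷ x) = Unique.map⁺ suc-injectiveᶠ (support-unique x)

support≡[]⇒𝟘 : ∀ {m} (x : Card m) → support x ≡ [] → x ≡ 𝟘 m
support≡[]⇒𝟘 []          _ = refl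
support≡[]⇒𝟘 (false ∷ x) supp≡[] = cong (false ∷_) (support≡[]⇒𝟘 x (map-≡[] supp≡[]))
  where
  map-≡[] : ∀ {xs : List (Fin _)} → map suc xs ≡ [] → xs ≡ []
  map-≡[] {[]} _ = refl

sum : ∀ {n} → List (Card n) → Card n
sum {n} = foldr _⊕_ (𝟘 n)

combination : ∀ {m n} → (Fin m → Card n) → Card m → Card n
combination s []      = 𝟘 _
combination s (b ∷ x) = scale b (s zero) ⊕ combination (s ∘ suc) x

combination-linear : ∀ {m n} (s : Fin m → Card n) → Linear (combination s)
combination-linear s []      []      = sym (⊕-self _)
combination-linear s (a ∷ x) (b ∷ y) = begin
  scale (a xor b) (s zero) ⊕ combination (s ∘ suc) (x ⊕ y)
    ≡⟨ cong₂ _⊕_ (scale-xor a b (s zero)) (combination-linear (s ∘ suc) x y) ⟩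
  (scale a (s zero) ⊕ scale b (s zero)) ⊕ (combination (s ∘ suc) x ⊕ combination (s ∘ suc) y)
    ≡⟨ ⊕-interchange (scale a (s zero)) _ _ _ ⟩
  (scale a (s zero) ⊕ combination (s ∘ suc) x) ⊕ (scale b (s zero) ⊕ combination (s ∘ suc) y)
    ∎
  where open ≡-Reasoning

combination≡sum-support : ∀ {m n} (s : Fin m → Card n) x → combination s x ≡ sum (map s (support x))
combination≡sum-support s []          = refl
combination≡sum-support s (true ∷ x)  =
  cong (s zero ⊕_) (trans (combination≡sum-support (s ∘ suc) x) (cong sum (map-∘ (support x))))
combination≡sum-support s (false ∷ x) =
  trans (⊕-identityˡ _) (trans (combination≡sum-support (s ∘ suc) x) (cong sum (map-∘ (support x))))

module _ {n M} {S : List (Card n)} (S-noQuads : NoQuads S) (s : Fin M → Card n)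
         (s-injective : ∀ {i j} → s i ≡ s j → i ≡ j) (s∈S : ∀ i → s i ∈ S) where

  -- A nonempty zero sum of distinct points with an even number < 6 of terms would be
  -- a repeated point or a quad; odd lengths are refuted by the parity hypothesis.
  shortEvenZeroSum⇒[] : (l : List (Fin M)) → Unique l → isOdd (length l) ≡ false →
                         sum (map s l) ≡ 𝟘 n → length l < 6 → l ≡ []
  shortEvenZeroSum⇒[] [] _ _ _ _ = refl
  shortEvenZeroSum⇒[] (i ∷ j ∷ []) ((i≢j All.∷ _) AllPairs.∷ _) _ sᵢ⊕sⱼ⊕𝟘≡𝟘 _ = ⊥-elim (i≢j (s-injective
    (x⊕y≡𝟘⇒x≡y (trans (cong (s i ⊕_) (sym (⊕-identityʳ (s j)))) sᵢ⊕sⱼ⊕𝟘≡𝟘))))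
  shortEvenZeroSum⇒[] (i ∷ j ∷ k ∷ l ∷ [])
    ((i≢j All.∷ i≢k All.∷ i≢l All.∷ _) AllPairs.∷ (j≢k All.∷ j≢l All.∷ _) AllPairs.∷
     (k≢l All.∷ _) AllPairs.∷ _)
    _ sum≡𝟘 _ =
    ⊥-elim (proj₂ S-noQuads (s i) (s j) (s k) (s l) (s∈S i) (s∈S j) (s∈S k) (s∈S l)
      (i≢j ∘ s-injective , i≢k ∘ s-injective , i≢l ∘ s-injective ,
       j≢k ∘ s-injective , j≢l ∘ s-injective , k≢l ∘ s-injective , quad-sum))
    where
    quad-sum : s i ⊕ s j ⊕ s k ⊕ s l ≡ 𝟘 n
    quad-sum = begin
      s i ⊕ s j ⊕ s k ⊕ s l               ≡⟨ ⊕-assoc (s i ⊕ s j) (s k) (s l) ⟩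
      s i ⊕ s j ⊕ (s k ⊕ s l)             ≡⟨ ⊕-assoc (s i) (s j) (s k ⊕ s l) ⟩
      s i ⊕ (s j ⊕ (s k ⊕ s l))           ≡⟨ cong (λ t → s i ⊕ (s j ⊕ (s k ⊕ t))) (⊕-identityʳ (s l)) ⟨
      s i ⊕ (s j ⊕ (s k ⊕ (s l ⊕ 𝟘 n)))   ≡⟨ sum≡𝟘 ⟩
      𝟘 n                                 ∎
      where open ≡-Reasoning
  shortEvenZeroSum⇒[] (_ ∷ _ ∷ _ ∷ _ ∷ _ ∷ _ ∷ _) _ _ _ (s≤s (s≤s (s≤s (s≤s (s≤s (s≤s ()))))))

  evenZeroCombination⇒minWeight6 : ∀ x → parity x ≡ false → combination s x ≡ 𝟘 n →
                                   x ≢ 𝟘 M → 6 ≤ weight x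
  evenZeroCombination⇒minWeight6 x even Σs≡𝟘 x≢𝟘 = ≮⇒≥ λ ∣x∣<6 →
    x≢𝟘 (support≡[]⇒𝟘 x (shortEvenZeroSum⇒[] (support x) (support-unique x)
      (trans (cong isOdd (length-support x)) (trans (sym (parity≡isOdd-weight x)) even))
      (trans (sym (combination≡sum-support s x)) Σs≡𝟘)
      (subst (_< 6) (sym (length-support x)) ∣x∣<6)))

kernel-linearCode6 : ∀ {m r} (ψ : Card m → Card r) → Linear ψ →
                     (∀ x → ψ x ≡ 𝟘 r → x ≢ 𝟘 m → 6 ≤ weight x) →
                     LinearCode6 m (enumerate m (kernel ψ)) ×
                     2 ^ m ≤ 2 ^ r * length (enumerate m (kernel ψ))
kernel-linearCode6 {m} {r} ψ ψ-linear ψ-weight =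
  ( enumerate-unique K
  , ∈-enumerate⁺ K (𝟘∈ K-subspace)
  , (λ x y x∈ y∈ → ∈-enumerate⁺ K (⊕-closed K-subspace x y (∈-enumerate⁻ K x∈) (∈-enumerate⁻ K y∈)))
  , (λ x x∈ → ψ-weight x (isZero⇒≡𝟘 (ψ x) (∈-enumerate⁻ K x∈)))
  ) , subst (λ c → 2 ^ m ≤ 2 ^ r * c) (sym (length-enumerate K)) (2^m≤2^r*card-kernel r ψ ψ-linear)
  where
  K = kernel ψ
  K-subspace = kernel-subspace ψ ψ-linear

Unique⇒lookup-injective : ∀ {A : Set} (xs : List A) → Unique xs →
                          ∀ {i j} → lookup xs i ≡ lookup xs j → i ≡ j
Unique⇒lookup-injective (x ∷ xs) _ {zero} {zero} _ = refl
Unique⇒lookup-injective (x ∷ xs) (x∉xs AllPairs.∷ _) {zero} {suc j} x≡xsⱼ =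
  ⊥-elim (All.lookup x∉xs (∈-lookup {xs = xs} j) x≡xsⱼ)
Unique⇒lookup-injective (x ∷ xs) (x∉xs AllPairs.∷ _) {suc i} {zero} xsᵢ≡x =
  ⊥-elim (All.lookup x∉xs (∈-lookup {xs = xs} i) (sym xsᵢ≡x))
Unique⇒lookup-injective (x ∷ xs) (_ AllPairs.∷ xs-unique) {suc i} {suc j} xsᵢ≡xsⱼ =
  cong suc (Unique⇒lookup-injective xs xs-unique xsᵢ≡xsⱼ)

-- The code of all even x ∈ Z₂ᴹ with Σᵢ xᵢ sᵢ = 0, for s₀, …, s_{M-1} the first M points of S.
noQuads⇒linearCode6 : ∀ {n} M (S : List (Card n)) → NoQuads S → M ≤ length S →
                      Σ[ K ∈ List (Card M) ] LinearCode6 M K × 2 ^ M ≤ 2 ^ suc n * length K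
noQuads⇒linearCode6 {n} M S S-noQuads M≤∣S∣ =
  enumerate M (kernel ψ) , kernel-linearCode6 ψ ψ-linear ψ-weight
  where
  s : Fin M → Card n
  s i = lookup S (inject≤ i M≤∣S∣)
  s-injective : ∀ {i j} → s i ≡ s j → i ≡ j
  s-injective = inject≤-injective M≤∣S∣ M≤∣S∣ _ _ ∘ Unique⇒lookup-injective S (proj₁ S-noQuads)
  ψ : Card M → Card (suc n)
  ψ x = parity x ∷ combination s x
  ψ-linear : Linear ψ
  ψ-linear x y = cong₂ _∷_ (parity-⊕ x y) (combination-linear s x y)
  ψ-weight : ∀ x → ψ x ≡ 𝟘 (suc n) → x ≢ 𝟘 M → 6 ≤ weight x
  ψ-weight x ψx≡𝟘 = evenZeroCombination⇒minWeight6 S-noQuads s s-injective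
    (λ i → ∈-lookup {xs = S} (inject≤ i M≤∣S∣)) x
    (proj₁ (∷-injective ψx≡𝟘)) (proj₂ (∷-injective ψx≡𝟘))

m+[1+n]≡o⇒o∸n∸1≡m : ∀ {m n o} → m + suc n ≡ o → o ∸ n ∸ 1 ≡ m
m+[1+n]≡o⇒o∸n∸1≡m {m} {n} refl = begin
  m + suc n ∸ n ∸ 1   ≡⟨ ∸-+-assoc (m + suc n) n 1 ⟩
  m + suc n ∸ (n + 1) ≡⟨ cong (m + suc n ∸_) (+-comm n 1) ⟩
  m + suc n ∸ suc n   ≡⟨ m+n∸n≡m m (suc n) ⟩
  m                   ∎
  where open ≡-Reasoning

2^m*c<2^[m+1+k] : ∀ m k {c} → c ≤ 2 ^ k → 2 ^ m * c < 2 ^ (m + suc k)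
2^m*c<2^[m+1+k] m k {c} c≤2^k = begin-strict
  2 ^ m * c         ≤⟨ *-monoʳ-≤ (2 ^ m) c≤2^k ⟩
  2 ^ m * 2 ^ k     <⟨ *-monoʳ-< (2 ^ m) {{m^n≢0 2 m}} (^-monoʳ-< 2 (s≤s (s≤s z≤n)) (n<1+n k)) ⟩
  2 ^ m * 2 ^ suc k ≡⟨ ^-distribˡ-+-* 2 m (suc k) ⟨
  2 ^ (m + suc k)   ∎
  where open ≤-Reasoning

-- Too many points would give a code with more than 2ᵏ words.
noQuads-length≤ : ∀ {ℓ r k} → r + suc k ≡ ℓ → (∀ K → LinearCode6 (ℓ + 1) K → length K ≤ 2 ^ k) →
                  (S : List (Card r)) → NoQuads S → length S ≤ ℓ
noQuads-length≤ {ℓ} {r} {k} r+1+k≡ℓ codes≤2^k S S-noQuads = ≮⇒≥ too-long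
  where
  too-long : ℓ < length S → ⊥
  too-long ℓ<∣S∣ with noQuads⇒linearCode6 (ℓ + 1) S S-noQuads (subst (_≤ length S) (+-comm 1 ℓ) ℓ<∣S∣)
  ... | K , K-code , 2^[ℓ+1]≤2^[1+r]∣K∣ = <⇒≱ (2^m*c<2^[m+1+k] (suc r) k (codes≤2^k K K-code)) (begin
    2 ^ (suc r + suc k)    ≡⟨ cong (λ d → 2 ^ suc d) r+1+k≡ℓ ⟩
    2 ^ suc ℓ              ≡⟨ cong (2 ^_) (+-comm 1 ℓ) ⟩
    2 ^ (ℓ + 1)            ≤⟨ 2^[ℓ+1]≤2^[1+r]∣K∣ ⟩
    2 ^ suc r * length K   ∎)
    where open ≤-Reasoning

theorem9 : (ℓ : ℕ) → 0 < ℓ → (b k : ℕ) → IsB ℓ b → b ≡ 2 ^ k →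
    ((f : ℕ) → IsF (ℓ ∸ k ∸ 1) f → ℓ ≤ f) ×
    ((b' : ℕ) → IsB (ℓ + 1) b' → b ≡ b' →
      (f : ℕ) → IsF (ℓ ∸ k ∸ 1) f → f ≡ ℓ)
theorem9 (suc ℓ) _ b k ((C , C-code , ∣C∣≡b) , _) b≡2^k
  with linearCode6⇒noQuads {k = k} C C-code (trans ∣C∣≡b b≡2^k)
... | r , r+1+k≡1+ℓ , S , S-noQuads , ∣S∣≡1+ℓ = lower , upper
  where
  IsF-r : ∀ {f} → IsF (suc ℓ ∸ k ∸ 1) f → IsF r f
  IsF-r = subst (λ d → IsF d _) (m+[1+n]≡o⇒o∸n∸1≡m r+1+k≡1+ℓ)
  lower : (f : ℕ) → IsF (suc ℓ ∸ k ∸ 1) f → suc ℓ ≤ f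
  lower f F = subst (_≤ f) ∣S∣≡1+ℓ (proj₂ (IsF-r F) S S-noQuads)
  upper : (b' : ℕ) → IsB (suc ℓ + 1) b' → b ≡ b' → (f : ℕ) → IsF (suc ℓ ∸ k ∸ 1) f → f ≡ suc ℓ
  upper b' (_ , B-max) b≡b' f F with IsF-r F
  ... | (S′ , S′-noQuads , ∣S′∣≡f) , _ = ≤-antisym
    (subst (_≤ suc ℓ) ∣S′∣≡f (noQuads-length≤ r+1+k≡1+ℓ codes≤2^k S′ S′-noQuads)) (lower f F)
    where
    codes≤2^k : ∀ K → LinearCode6 (suc ℓ + 1) K → length K ≤ 2 ^ k
    codes≤2^k K K-code = subst (length K ≤_) (trans (sym b≡b') b≡2^k) (B-max K K-code)
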